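{- Let $\varphi$ be a CNF and let $(T,\{B(t)\})$ be a one-sided tree decomposition of the incidence graph of $\varphi$, with $T$ a rooted binary tree. Let $x$ be a leaf of $T$, let $CL'\subseteq CL(x)$, let $S$ be an assignment to $Var(par(x))$ such that $\Phi(x,CL',S)$ is unsatisfiable, and let $S'$ be an assignment to $Var(x)\setminus Var(par(x))$. Then $\Phi(x,CL',S)|_{S'}$ contains the empty clause.
   Context: A CNF is a set of clauses, a clause a set of literals; sets of literals never contain a literal together with its negation, and an assignment to a set $V$ of variables is a set of literals whose variables are exactly $V$. A set $S$ of literals satisfies a clause $C$ if $C\cap S\neq\emptyset$; otherwise $C|_S=C\setminus\{\neg\ell:\ell\in S\}$. For a CNF $\psi$, $\psi|_S$ is the set of all $C|_S$ with $C\in\psi$ not satisfied by $S$. For a set $C$ of literals and a set $V$ of variables, $Proj(C,V)$ is the set of literals of $C$ whose variable lies in $V$. The incidence graph of $\varphi$ has the variables and clauses of $\varphi$ as vertices, $x$ adjacent to $C$ iff $x$ occurs in $C$. A tree decomposition of it with rooted $T$ is one-sided if for each clause $C$ the nodes whose bags contain $C$ induce a directed (ancestor-to-descendant) path. For a node $t$, $Var(t)$ and $CL(t)$ are the variables and clauses in $B(t)$; $T_t$ is the subtree consisting of $t$ and its descendants and $Var(T_t)=\bigcup_{u\in V(T_t)}Var(u)$; $par(t)$ is the parent of $t$, with $Var(par(t))=\emptyset$ if $t$ is the root. For a node $x$ and a set $CL'$ of clauses, $\Phi(x,CL')$ is obtained from $\varphi\setminus CL'$ by deleting every clause with no variable in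 $Var(T_x)$ and replacing each remaining clause $C$ by $Proj(C,Var(T_x))$; $\Phi(x,CL',S)=\Phi(x,CL')|_S$. -}

module Defs where

open import Data.Nat using (ℕ)
open import Data.Bool using (Bool; not)
open import Data.Fin using (Fin)
open import Data.List using (List; []; _∷_)
open import Data.List.Membership.Propositional using (_∈_)
open import Data.Product using (Σ; ∃; ∃-syntax; _×_; _,_; proj₁)
open import Data.Unit using (⊤)
open import Data.Sum using (_⊎_)
open import Data.Empty using (⊥)
open import Relation.Nullary using (¬_)

Lit : Set
Lit = ℕ × Bool

neg : Lit → Lit
neg (v , b) = v , not b

var : Lit → ℕ
var = proj₁

-- A finite set of literals is represented by a list (duplicates irrelevant).
-- "never contains a literal together with its negation"
Consistent : List Lit → Set
Consistent S = ∀ l → l ∈ S → neg l ∈ S → ⊥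

-- A set of literals given by a membership predicate (used for derived clauses).
LitPred : Set₁
LitPred = Lit → Set

Occurs : ℕ → List Lit → Set
Occurs v C = ∃[ b ] ((v , b) ∈ C)

IsAssignment : (ℕ → Set) → List Lit → Set
IsAssignment V S =
  Consistent S × (∀ v → V v → Occurs v S) × (∀ l → l ∈ S → V (var l))

record CNF : Set₁ where
  field
    Idx    : Set
    clause : Idx → LitPred
open CNF public

Sat : List Lit → LitPred → Set
Sat S C = ∃[ l ] (C l × l ∈ S)

restrictClause : LitPred → List Lit → LitPred
restrictClause C S l = C l × ¬ (neg l ∈ S)

restrict : CNF → List Lit → CNF
restrict ψ S = record
  { Idx    = Σ (Idx ψ) (λ i → ¬ Sat S (clause ψ i))
  ; clause = λ p → restrictClause (clause ψ (proj₁ p)) S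
  }

Satisfiable : CNF → Set
Satisfiable ψ = ∃[ S ] (Consistent S × (∀ i → Sat S (clause ψ i)))

ContainsEmptyClause : CNF → Set
ContainsEmptyClause ψ = ∃[ i ] (∀ l → ¬ clause ψ i l)

data BTree (A : Set) : Set where
  leaf  : A → BTree A
  node1 : A → BTree A → BTree A
  node2 : A → BTree A → BTree A → BTree A

data Pos {A : Set} : BTree A → Set where
  here : ∀ {t} → Pos t
  in1  : ∀ {a s} → Pos s → Pos (node1 a s)
  inL  : ∀ {a l r} → Pos l → Pos (node2 a l r)
  inR  : ∀ {a l r} → Pos r → Pos (node2 a l r)

label : ∀ {A} (t : BTree A) → Pos t → A
label (leaf a)       here    = a
label (node1 a s)    here    = a
label (node2 a l r)  here    = a
label (node1 a s)    (in1 p) = label s p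
label (node2 a l r)  (inL p) = label l p
label (node2 a l r)  (inR p) = label r p

data Child {A : Set} : {t : BTree A} → Pos t → Pos t → Set where
  c1  : ∀ {a s} → Child {t = node1 a s} here (in1 here)
  cL  : ∀ {a l r} → Child {t = node2 a l r} here (inL here)
  cR  : ∀ {a l r} → Child {t = node2 a l r} here (inR here)
  c1↑ : ∀ {a s} {p q : Pos s} → Child p q → Child {t = node1 a s} (in1 p) (in1 q)
  cL↑ : ∀ {a l r} {p q : Pos l} → Child p q → Child {t = node2 a l r} (inL p) (inL q)
  cR↑ : ∀ {a l r} {p q : Pos r} → Child p q → Child {t = node2 a l r} (inR p) (inR q)

data Desc {A : Set} {t : BTree A} : Pos t → Pos t → Set where
  desc-refl : ∀ {p} → Desc p p
  desc-step : ∀ {p q r} → Child p q → Desc q r → Desc p r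

IsLeaf : ∀ {A} (t : BTree A) → Pos t → Set
IsLeaf t x = ∀ q → ¬ Child x q

Adj : ∀ {A} {t : BTree A} → Pos t → Pos t → Set
Adj p q = Child p q ⊎ Child q p

data Walk {A : Set} {t : BTree A} (P : Pos t → Set) : Pos t → Pos t → Set where
  nil  : ∀ {p} → P p → Walk P p p
  cons : ∀ {p q r} → P p → Adj p q → Walk P q r → Walk P p r

Connected : ∀ {A} {t : BTree A} → (Pos t → Set) → Set
Connected P = ∀ p q → P p → P q → Walk P p q

Chain : ∀ {A} {t : BTree A} → List (Pos t) → Set
Chain []            = ⊤
Chain (p ∷ [])      = ⊤
Chain (p ∷ q ∷ ps)  = Child p q × Chain (q ∷ ps)

DirectedPath : ∀ {A} {t : BTree A} → (Pos t → Set) → Set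
DirectedPath {t = t} P =
  ∃[ ps ] (Chain ps × (∀ p → P p → p ∈ ps) × (∀ p → p ∈ ps → P p))

data Vertex (m : ℕ) : Set where
  vvar : ℕ → Vertex m
  vcls : Fin m → Vertex m

Bag : ℕ → Set
Bag m = List (Vertex m)

record IsOneSidedTD {m : ℕ} (φ : Fin m → List Lit) (T : BTree (Bag m)) : Set where
  field
    bag-vars   : ∀ p v → vvar v ∈ label T p → ∃[ i ] Occurs v (φ i)
    cover-var  : ∀ v i → Occurs v (φ i) → ∃[ p ] (vvar v ∈ label T p)
    cover-cls  : ∀ i → ∃[ p ] (vcls i ∈ label T p)
    cover-edge : ∀ v i → Occurs v (φ i) →
                 ∃[ p ] (vvar v ∈ label T p × vcls i ∈ label T p)
    conn-var   : ∀ v → Connected (λ p → vvar v ∈ label T p)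
    conn-cls   : ∀ i → Connected (λ p → vcls i ∈ label T p)
    one-sided  : ∀ i → DirectedPath (λ p → vcls i ∈ label T p)

-- Var(t), Var(T_t), Var(par(t)) (empty for the root)
VarAt : ∀ {m} (T : BTree (Bag m)) → Pos T → ℕ → Set
VarAt T x v = vvar v ∈ label T x

VarSub : ∀ {m} (T : BTree (Bag m)) → Pos T → ℕ → Set
VarSub T x v = ∃[ q ] (Desc x q × VarAt T q v)

VarPar : ∀ {m} (T : BTree (Bag m)) → Pos T → ℕ → Set
VarPar T x v = ∃[ p ] (Child p x × VarAt T p v)

Φ : ∀ {m} (φ : Fin m → List Lit) (T : BTree (Bag m)) → Pos T → List (Fin m) → CNF
Φ {m} φ T x CL' = record
  { Idx    = Σ (Fin m) (λ i → ¬ (i ∈ CL') × ∃[ v ] (Occurs v (φ i) × VarSub T x v))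
  ; clause = λ p l → (l ∈ φ (proj₁ p)) × VarSub T x (var l)
  }

ΦS : ∀ {m} (φ : Fin m → List Lit) (T : BTree (Bag m)) → Pos T → List (Fin m) → List Lit → CNF
ΦS φ T x CL' S = restrict (Φ φ T x CL') S

-- At a leaf x the subtree T_x is the single node x, so every clause of Φ(x, CL') is
-- projected onto Var(x). Together S and S' assign all of Var(x), hence R = S ∪ S' is a
-- consistent set of literals that decides every literal of every clause of Φ(x, CL').
-- If R falsified no clause, it would satisfy Φ(x, CL', S); so some clause is falsified by
-- R, and such a clause becomes empty after restricting by S and then by S'. Constructively
-- the falsified clause is found by a decidable search over the finitely many clauses of φ.
module Submission where

open import Defs
open import Data.Fin using (Fin)
open import Data.List using (List; _++_)
open import Data.List.Membership.Propositional using (_∈_; find; lose)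
open import Data.Product using (_×_)
open import Relation.Nullary using (¬_)
open import Relation.Binary.PropositionalEquality using (_≡_)

open import Function using (_∘_)
open import Data.Bool using (true; false)
open import Data.Product using (_,_; proj₁; proj₂; map₂)
open import Data.Sum using (_⊎_; inj₁; inj₂; [_,_])
open import Data.Empty using (⊥-elim)
open import Relation.Nullary using (Dec; yes; no)
open import Relation.Nullary.Decidable using (¬?; _×-dec_; _→-dec_; map′)
open import Relation.Binary using (DecidableEquality)
open import Relation.Binary.PropositionalEquality using (refl; cong; _≢_)
open import Data.List.Relation.Unary.Any using (Any; any?)
open import Data.List.Relation.Unary.All using (All; all?; lookup)
open import Data.List.Relation.Unary.All.Properties using (¬All⇒Any¬)
open import Data.List.Membership.Propositional.Properties using (∈-++⁺ˡ; ∈-++⁺ʳ; ∈-++⁻)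
import Data.Nat.Properties as ℕ
import Data.Fin.Properties as Fin
import Data.Bool.Properties as Bool
import Data.Product.Properties as Product

_≟ₗ_ : DecidableEquality Lit
_≟ₗ_ = Product.≡-dec ℕ._≟_ Bool._≟_

_∈ₗ?_ : ∀ l R → Dec (l ∈ R)
l ∈ₗ? R = any? (l ≟ₗ_) R

vvar-≟ : ∀ {m} v (u : Vertex m) → Dec (vvar v ≡ u)
vvar-≟ v (vvar w) = map′ (cong vvar) (λ { refl → refl }) (v ℕ.≟ w)
vvar-≟ v (vcls i) = no λ ()

VarAt? : ∀ {m} (T : BTree (Bag m)) x v → Dec (VarAt T x v)
VarAt? T x v = any? (vvar-≟ v) (label T x)

occurs⇒assigned : ∀ l {R} → Occurs (var l) R → l ∈ R ⊎ neg l ∈ R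
occurs⇒assigned (v , true)  (true  , l∈R) = inj₁ l∈R
occurs⇒assigned (v , true)  (false , l∈R) = inj₂ l∈R
occurs⇒assigned (v , false) (false , l∈R) = inj₁ l∈R
occurs⇒assigned (v , false) (true  , l∈R) = inj₂ l∈R

++-consistent : ∀ {S S'} → Consistent S → Consistent S' →
                (∀ {l l'} → l ∈ S → l' ∈ S' → var l ≢ var l') → Consistent (S ++ S')
++-consistent {S} cS cS' disjoint (v , b) l∈ ¬l∈ with ∈-++⁻ S l∈ | ∈-++⁻ S ¬l∈
... | inj₁ p | inj₁ q = cS  _ p q
... | inj₂ p | inj₂ q = cS' _ p q
... | inj₁ p | inj₂ q = disjoint p q refl
... | inj₂ p | inj₁ q = disjoint q p refl

Sat-mono : ∀ {R R' C} → (∀ {l} → l ∈ R → l ∈ R') → Sat R C → Sat R' C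
Sat-mono R⊆R' = map₂ (map₂ R⊆R')

falsified⇒¬Sat : ∀ {R C} → Consistent R → (∀ l → C l → neg l ∈ R) → ¬ Sat R C
falsified⇒¬Sat consistent falsified (l , Cl , l∈R) = consistent l l∈R (falsified l Cl)

falsified⇒restrict²-empty : ∀ {C} S S' → (∀ l → C l → neg l ∈ S ++ S') →
                            ∀ l → ¬ restrictClause (restrictClause C S) S' l
falsified⇒restrict²-empty S S' falsified l ((Cl , ¬l∉S) , ¬l∉S')
  with ∈-++⁻ S (falsified l Cl)
... | inj₁ ¬l∈S  = ¬l∉S ¬l∈S
... | inj₂ ¬l∈S' = ¬l∉S' ¬l∈S'

leaf-VarSub⇒VarAt : ∀ {m} (T : BTree (Bag m)) {x} → IsLeaf T x → ∀ {v} → VarSub T x v → VarAt T x v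
leaf-VarSub⇒VarAt T x-leaf (_ , desc-refl     , v∈x) = v∈x
leaf-VarSub⇒VarAt T x-leaf (_ , desc-step c _ , _)   = ⊥-elim (x-leaf _ c)

module AtLeaf {m} (φ : Fin m → List Lit) (T : BTree (Bag m)) {x : Pos T} (x-leaf : IsLeaf T x)
              (CL' : List (Fin m)) (S S' : List Lit)
              (S-assigns : IsAssignment (VarPar T x) S)
              (S'-assigns : IsAssignment (λ v → VarAt T x v × ¬ VarPar T x v) S') where

  R : List Lit
  R = S ++ S'

  R-consistent : Consistent R
  R-consistent = ++-consistent (proj₁ S-assigns) (proj₁ S'-assigns) disjoint
    where
    disjoint : ∀ {l l'} → l ∈ S → l' ∈ S' → var l ≢ var l'
    disjoint l∈S l'∈S' refl = proj₂ (proj₂ (proj₂ S'-assigns) _ l'∈S') (proj₂ (proj₂ S-assigns) _ l∈S)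

  -- Whether v ∈ Var(par(x)) is not decidable, so S ∪ S' covers Var(x) only up to ¬¬.
  R-covers : ∀ v → VarAt T x v → ¬ ¬ Occurs v R
  R-covers v v∈x ¬occurs = ¬occurs (map₂ (∈-++⁺ʳ S) (proj₁ (proj₂ S'-assigns) v (v∈x , ¬par)))
    where
    ¬par : ¬ VarPar T x v
    ¬par par = ¬occurs (map₂ ∈-++⁺ˡ (proj₁ (proj₂ S-assigns) v par))

  R-assigns : ∀ l → VarAt T x (var l) → l ∈ R ⊎ neg l ∈ R
  R-assigns l l∈x with l ∈ₗ? R | neg l ∈ₗ? R
  ... | yes l∈R | _        = inj₁ l∈R
  ... | no _    | yes ¬l∈R = inj₂ ¬l∈R
  ... | no l∉R  | no ¬l∉R  =
    ⊥-elim (R-covers (var l) l∈x λ occ → [ l∉R , ¬l∉R ] (occurs⇒assigned l occ))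

  Falsified : Fin m → Set
  Falsified j = ¬ (j ∈ CL')
              × Any (VarAt T x ∘ var) (φ j)
              × All (λ l → VarAt T x (var l) → neg l ∈ R) (φ j)

  Falsified? : ∀ j → Dec (Falsified j)
  Falsified? j = ¬? (any? (Fin._≟_ j) CL')
           ×-dec any? (VarAt? T x ∘ var) (φ j)
           ×-dec all? (λ l → VarAt? T x (var l) →-dec (neg l ∈ₗ? R)) (φ j)

  Φ-clause-falsified : ∀ {j} → All (λ l → VarAt T x (var l) → neg l ∈ R) (φ j) →
                       ∀ {i} → proj₁ i ≡ j → ∀ l → clause (Φ φ T x CL') i l → neg l ∈ R
  Φ-clause-falsified falsified refl l (l∈φj , l∈Tx) = lookup falsified l∈φj (leaf-VarSub⇒VarAt T x-leaf l∈Tx)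

  falsified⇒emptyClause : ∀ {j} → Falsified j → ContainsEmptyClause (restrict (ΦS φ T x CL' S) S')
  falsified⇒emptyClause {j} (j∉CL' , meets-x , falsified) =
    ((i , ¬Sat-S) , ¬Sat-S') , falsified⇒restrict²-empty S S' i-falsified
    where
    i : Idx (Φ φ T x CL')
    i with find meets-x
    ... | ((v , b) , l∈φj , v∈x) = j , j∉CL' , v , (b , l∈φj) , x , desc-refl , v∈x
    i-falsified : ∀ l → clause (Φ φ T x CL') i l → neg l ∈ R
    i-falsified = Φ-clause-falsified falsified {i} refl
    ¬Sat-S : ¬ Sat S (clause (Φ φ T x CL') i)
    ¬Sat-S = falsified⇒¬Sat R-consistent i-falsified ∘ Sat-mono ∈-++⁺ˡ
    ¬Sat-S' : ¬ Sat S' (restrictClause (clause (Φ φ T x CL') i) S)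
    ¬Sat-S' = falsified⇒¬Sat R-consistent (λ l → i-falsified l ∘ proj₁) ∘ Sat-mono (∈-++⁺ʳ S)

  none-falsified⇒satisfiable : (∀ j → ¬ Falsified j) → Satisfiable (ΦS φ T x CL' S)
  none-falsified⇒satisfiable none = R , R-consistent , satisfied
    where
    satisfied : ∀ i → Sat R (clause (ΦS φ T x CL' S) i)
    satisfied ((j , j∉CL' , v , (b , l∈φj) , v∈Tx) , _)
      with find (¬All⇒Any¬ (λ l → VarAt? T x (var l) →-dec (neg l ∈ₗ? R)) (φ j)
                  (none j ∘ (j∉CL' ,_) ∘ (lose l∈φj (leaf-VarSub⇒VarAt T x-leaf v∈Tx) ,_)))
    ... | (l , l∈φj' , ¬falsified) with VarAt? T x (var l)
    ...   | no l∉x  = ⊥-elim (¬falsified (⊥-elim ∘ l∉x))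
    ...   | yes l∈x with R-assigns l l∈x
    ...     | inj₂ ¬l∈R = ⊥-elim (¬falsified λ _ → ¬l∈R)
    ...     | inj₁ l∈R  = l , ((l∈φj' , x , desc-refl , l∈x) , R-consistent l l∈R ∘ ∈-++⁺ˡ) , l∈R

  unsatisfiable⇒emptyClause : ¬ Satisfiable (ΦS φ T x CL' S) →
                              ContainsEmptyClause (restrict (ΦS φ T x CL' S) S')
  unsatisfiable⇒emptyClause unsat with Fin.any? Falsified?
  ... | yes (_ , falsified) = falsified⇒emptyClause falsified
  ... | no  none            = ⊥-elim (unsat (none-falsified⇒satisfiable λ j f → none (j , f)))

corollary1 : ∀ {m} (φ : Fin m → List Lit)
    → (∀ i → Consistent (φ i))
    → (∀ i j → (∀ l → l ∈ φ i → l ∈ φ j) → (∀ l → l ∈ φ j → l ∈ φ i) → i ≡ j)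
    → (T : BTree (Bag m)) → IsOneSidedTD φ T
    → (x : Pos T) → IsLeaf T x
    → (CL' : List (Fin m)) → (∀ i → i ∈ CL' → vcls i ∈ label T x)
    → (S : List Lit) → IsAssignment (VarPar T x) S
    → ¬ Satisfiable (ΦS φ T x CL' S)
    → (S' : List Lit) → IsAssignment (λ v → VarAt T x v × ¬ VarPar T x v) S'
    → ContainsEmptyClause (restrict (ΦS φ T x CL' S) S')
corollary1 φ _ _ T _ x x-leaf CL' _ S S-assigns unsat S' S'-assigns =
  AtLeaf.unsatisfiable⇒emptyClause φ T x-leaf CL' S S' S-assigns S'-assigns unsat
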